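{- Let $p$ be a prime, let $G$ be a connected graph, let $V$ be a set of marked vertices of $G$, and suppose $c\in V$ is 2-valent in $G$. Let $G^{(p-1)}$ be the multigraph with $p-1$ copies of each edge of $G$. Suppose $\pi=(\psi_1,\ldots,\psi_{p-1},\phi_1,\ldots,\phi_{p-1})$ is a partition of the edges of $G^{(p-1)}$ (copies of an edge not distinguished) in which each $\psi_j$ is a spanning tree of $G$ and each $\phi_j$ is a spanning 2-forest of $G$ compatible with a bipartition of $V$ in which every part contains at least one vertex of $V\setminus\{c\}$. Then each of the $2p-2$ parts of $\pi$ contains exactly one edge incident to $c$. Furthermore, for every $i$ there exists a spanning tree $\psi_j$ whose edge incident to $c$ differs from that of $\phi_i$; and for any such pair $\phi_i,\psi_j$, swapping these two edges incident to $c$ between $\phi_i$ and $\psi_j$ yields a new edge partition $\pi'$ with the same properties, except that the bipartition of $V$ with which the new $\phi'_i$ is compatible may differ from that of $\phi_i$.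
   Context: A spanning 2-forest is a spanning forest with exactly two trees; it is compatible with a bipartition $A\cup B$ of $V$ if one tree contains all of $A$ and none of $B$ and the other contains all of $B$ and none of $A$. An edge partition of $G^{(p-1)}$ into subgraphs of $G$ means an ordered tuple of subgraphs of $G$ in which every edge of $G$ lies in exactly $p-1$ of the subgraphs. -}

module Defs where

open import Data.Nat using (ℕ; zero; suc; _+_; _∸_)
open import Data.Fin using (Fin; zero; suc; _≟_)
open import Data.Bool using (Bool; true; false; if_then_else_)
open import Data.Product using (Σ; ∃; _×_; _,_; proj₁; proj₂)
open import Data.Sum using (_⊎_)
open import Relation.Binary.PropositionalEquality using (_≡_; _≢_)
open import Relation.Nullary using (¬_; does)

Graph : ℕ → ℕ → Set
Graph n m = Fin m → Fin n × Fin n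

EdgeSet : ℕ → Set
EdgeSet m = Fin m → Bool

VertexSet : ℕ → Set
VertexSet n = Fin n → Bool

count : ∀ {k} → (Fin k → Bool) → ℕ
count {zero} f = 0
count {suc k} f = (if f zero then 1 else 0) + count (λ i → f (suc i))

data Conn {n m} (G : Graph n m) (S : EdgeSet m) : Fin n → Fin n → Set where
  here : ∀ {x} → Conn G S x x
  fwd  : ∀ {x y} (e : Fin m) → S e ≡ true → proj₁ (G e) ≡ x →
         Conn G S (proj₂ (G e)) y → Conn G S x y
  bwd  : ∀ {x y} (e : Fin m) → S e ≡ true → proj₂ (G e) ≡ x →
         Conn G S (proj₁ (G e)) y → Conn G S x y

allEdges : ∀ {m} → EdgeSet m
allEdges _ = true

Connected : ∀ {n m} → Graph n m → Set
Connected G = ∀ x y → Conn G allEdges x y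

remove : ∀ {m} → EdgeSet m → Fin m → EdgeSet m
remove S e x = if does (x ≟ e) then false else S x

-- Forest: the subgraph has no cycle, i.e. every edge of S is a bridge of S
-- (its ends are disconnected once it is removed; this also excludes loops).
IsForest : ∀ {n m} → Graph n m → EdgeSet m → Set
IsForest G S = ∀ e → S e ≡ true → ¬ Conn G (remove S e) (proj₁ (G e)) (proj₂ (G e))

IsSpanningTree : ∀ {n m} → Graph n m → EdgeSet m → Set
IsSpanningTree G S = IsForest G S × (∀ x y → Conn G S x y)

IsSpanning2Forest : ∀ {n m} → Graph n m → EdgeSet m → Set
IsSpanning2Forest {n} G S =
  IsForest G S × Σ (Fin n) λ u → Σ (Fin n) λ v →
    ¬ Conn G S u v × (∀ x → Conn G S x u ⊎ Conn G S x v)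

-- A bipartition A ∪ B of V is given by side : V → Bool (A = side true, B = side false).
-- Compatibility: each part lies in a single tree, and the two parts lie in different trees.
CompatibleWith : ∀ {n m} → Graph n m → EdgeSet m → VertexSet n → (Fin n → Bool) → Set
CompatibleWith G S V side =
  (∀ x y → V x ≡ true → V y ≡ true → side x ≡ side y → Conn G S x y) ×
  (∀ x y → V x ≡ true → V y ≡ true → side x ≢ side y → ¬ Conn G S x y)

GoodBipartition : ∀ {n} → VertexSet n → Fin n → (Fin n → Bool) → Set
GoodBipartition {n} V c side =
  (Σ (Fin n) λ x → V x ≡ true × x ≢ c × side x ≡ true) ×
  (Σ (Fin n) λ y → V y ≡ true × y ≢ c × side y ≡ false)

Good2Forest : ∀ {n m} → Graph n m → VertexSet n → Fin n → EdgeSet m → Set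
Good2Forest G V c S =
  IsSpanning2Forest G S ×
  Σ (Fin _ → Bool) λ side → GoodBipartition V c side × CompatibleWith G S V side

-- (ψ₁..ψₖ, φ₁..φₖ) with k = p-1 is an edge partition of G^(k):
-- every edge of G lies in exactly k of the 2k subgraphs.
IsEdgePartition : ∀ {m} (k : ℕ) → (Fin k → EdgeSet m) → (Fin k → EdgeSet m) → Set
IsEdgePartition {m} k ψ φ = ∀ (e : Fin m) → count (λ j → ψ j e) + count (λ j → φ j e) ≡ k

GoodPartition : ∀ {n m} → Graph n m → VertexSet n → Fin n → (k : ℕ) →
                (Fin k → EdgeSet m) → (Fin k → EdgeSet m) → Set
GoodPartition G V c k ψ φ =
  IsEdgePartition k ψ φ × (∀ j → IsSpanningTree G (ψ j)) × (∀ i → Good2Forest G V c (φ i))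

-- Degree (a loop counts twice).
degree : ∀ {n m} → Graph n m → Fin n → ℕ
degree G c = count (λ e → does (proj₁ (G e) ≟ c)) + count (λ e → does (proj₂ (G e) ≟ c))

Incident : ∀ {n m} → Graph n m → Fin m → Fin n → Set
Incident G e c = proj₁ (G e) ≡ c ⊎ proj₂ (G e) ≡ c

ExactlyOneAt : ∀ {n m} → Graph n m → Fin n → EdgeSet m → Set
ExactlyOneAt {n} {m} G c S =
  Σ (Fin m) λ e → S e ≡ true × Incident G e c ×
    (∀ e' → S e' ≡ true → Incident G e' c → e' ≡ e)

swapEdge : ∀ {m} → EdgeSet m → Fin m → Fin m → EdgeSet m
swapEdge S out in' x =
  if does (x ≟ out) then false else (if does (x ≟ in') then true else S x)

update : ∀ {k m} → (Fin k → EdgeSet m) → Fin k → EdgeSet m → Fin k → EdgeSet m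
update f j v i = if does (i ≟ j) then v else f i

-- Every part contains an edge at c: a spanning tree reaches some vertex of V ∖ {c}, and in a
-- compatible 2-forest c is joined to a vertex of V ∖ {c} on its own side. Since c has only two
-- incident edges and each edge lies in exactly k = p - 1 of the 2k parts, a part containing both
-- would force another part to contain neither; hence every part contains exactly one. An edge at c
-- lying in φ i lies in at most k - 1 trees, which gives the partner ψ j. Finally, c is a leaf of
-- every part, and replacing the leaf edge at c by the other edge at c neither changes the
-- connectivity among the remaining vertices nor creates a cycle: trees stay spanning trees, and a
-- 2-forest stays a 2-forest separating the same two vertices of V ∖ {c}, with c moving to the side
-- of its new neighbour.
module Submission where

open import Defs
open import Data.Nat using (ℕ; zero; suc; _+_; _≤_; _∸_; s≤s)
open import Data.Nat.Properties
  using (≤-trans; m≤m+n; +-identityʳ; +-cancelˡ-≡; m+n≡0⇒m≡0; m+n≡0⇒n≡0; +-commutativeSemigroup)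
open import Algebra.Properties.CommutativeSemigroup +-commutativeSemigroup
  using (interchange; x∙yz≈y∙xz)
open import Data.Nat.Primality using (Prime)
open import Data.Fin using (Fin; zero; suc; _≟_)
open import Data.Fin.Properties using (¬∀⟶∃¬)
open import Data.Bool using (Bool; true; false; if_then_else_; _∨_; _∧_)
open import Data.Bool.Properties using (∨-zeroʳ; ¬-not) renaming (_≟_ to _≟ᵇ_)
open import Data.Product using (Σ; ∃; _×_; _,_; proj₁; proj₂)
open import Data.Sum as Sum using (_⊎_; inj₁; inj₂; [_,_]′)
open import Data.Empty using (⊥-elim)
open import Function using (_∘_; id; const)
open import Relation.Binary.PropositionalEquality
  using (_≡_; _≢_; refl; sym; trans; cong; cong₂; subst; subst₂; ≢-sym; module ≡-Reasoning)
open import Relation.Nullary using (¬_; does; yes; no; contradiction)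
open import Relation.Nullary.Decidable using (dec-true; dec-false; decidable-stable)

open ≡-Reasoning

bit : Bool → ℕ
bit b = if b then 1 else 0

bit≡0⇒false : ∀ {b} → bit b ≡ 0 → b ≡ false
bit≡0⇒false {false} _ = refl

bit-∨+bit-∧ : ∀ x y → bit (x ∨ y) + bit (x ∧ y) ≡ bit x + bit y
bit-∨+bit-∧ true  y     = refl
bit-∨+bit-∧ false true  = refl
bit-∨+bit-∧ false false = refl

∧-false : ∀ {x y} → x ∧ y ≡ false → x ≡ true → y ≡ false
∧-false x∧y≡false refl = x∧y≡false

count-cong : ∀ {k} {h h' : Fin k → Bool} → (∀ l → h l ≡ h' l) → count h ≡ count h'
count-cong {zero}  _    = refl
count-cong {suc k} h≗h' = cong₂ _+_ (cong bit (h≗h' zero)) (count-cong (h≗h' ∘ suc))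

count-true : ∀ {k} {h : Fin k → Bool} → (∀ l → h l ≡ true) → count h ≡ k
count-true {zero}  _   = refl
count-true {suc k} {h} all rewrite all zero = cong suc (count-true (all ∘ suc))

count-remove : ∀ {k} (h : Fin k → Bool) j → count h ≡ bit (h j) + count (remove h j)
count-remove h zero    = refl
count-remove h (suc j) = begin
  bit (h zero) + count (h ∘ suc)
    ≡⟨ cong (bit (h zero) +_) (count-remove (h ∘ suc) j) ⟩
  bit (h zero) + (bit (h (suc j)) + count (remove (h ∘ suc) j))
    ≡⟨ x∙yz≈y∙xz (bit (h zero)) (bit (h (suc j))) (count (remove (h ∘ suc) j)) ⟩
  bit (h (suc j)) + (bit (h zero) + count (remove (h ∘ suc) j))
    ∎

count-remove-true : ∀ {k} (h : Fin k → Bool) {j} → h j ≡ true → count h ≡ suc (count (remove h j))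
count-remove-true h {j} hj = trans (count-remove h j) (cong (λ b → bit b + count (remove h j)) hj)

count≡0⇒false : ∀ {k} {h : Fin k → Bool} → count h ≡ 0 → ∀ l → h l ≡ false
count≡0⇒false {h = h} count≡0 l =
  bit≡0⇒false (m+n≡0⇒m≡0 (bit (h l)) (trans (sym (count-remove h l)) count≡0))

count-∨+count-∧ : ∀ {k} (a b : Fin k → Bool) →
  count (λ l → a l ∨ b l) + count (λ l → a l ∧ b l) ≡ count a + count b
count-∨+count-∧ {zero}  a b = refl
count-∨+count-∧ {suc k} a b =
  trans (interchange (bit (a zero ∨ b zero)) _ (bit (a zero ∧ b zero)) _)
    (trans (cong₂ _+_ (bit-∨+bit-∧ (a zero) (b zero)) (count-∨+count-∧ (a ∘ suc) (b ∘ suc)))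
      (interchange (bit (a zero)) (bit (b zero)) _ _))

remove-≢ : ∀ {k} (h : Fin k → Bool) {j l} → l ≢ j → remove h j l ≡ h l
remove-≢ h {j} {l} l≢j rewrite dec-false (l ≟ j) l≢j = refl

count-≥3 : ∀ {k} (h : Fin k → Bool) {x y z} → y ≢ x → z ≢ x → z ≢ y →
  h x ≡ true → h y ≡ true → h z ≡ true → 3 ≤ count h
count-≥3 h {x} {y} {z} y≢x z≢x z≢y hx hy hz = subst (3 ≤_) (sym count≡3+) (m≤m+n 3 _)
  where
  count≡3+ : count h ≡ 3 + count (remove (remove (remove h x) y) z)
  count≡3+ = trans (count-remove-true h hx) (cong suc
    (trans (count-remove-true (remove h x) (trans (remove-≢ h y≢x) hy)) (cong suc
      (count-remove-true (remove (remove h x) y)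
        (trans (remove-≢ (remove h x) z≢y) (trans (remove-≢ h z≢x) hz))))))

remove-true⁻ : ∀ {m} (A : EdgeSet m) {g f} → remove A g f ≡ true → f ≢ g × A f ≡ true
remove-true⁻ A {g} {f} Af with f ≟ g
... | no f≢g = f≢g , Af

remove-true⁺ : ∀ {m} (A : EdgeSet m) {g f} → f ≢ g → A f ≡ true → remove A g f ≡ true
remove-true⁺ A f≢g Af = trans (remove-≢ A f≢g) Af

swapEdge-in : ∀ {m} (S : EdgeSet m) {out inn} → inn ≢ out → swapEdge S out inn inn ≡ true
swapEdge-in S {out} {inn} inn≢out
  rewrite dec-false (inn ≟ out) inn≢out | dec-true (inn ≟ inn) refl = refl

swapEdge-keep : ∀ {m} (S : EdgeSet m) {out inn f} →
  f ≢ out → S f ≡ true → swapEdge S out inn f ≡ true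
swapEdge-keep S {out} {inn} {f} f≢out Sf rewrite dec-false (f ≟ out) f≢out with does (f ≟ inn)
... | true  = refl
... | false = Sf

swapEdge-true⁻ : ∀ {m} (S : EdgeSet m) {out inn f} →
  swapEdge S out inn f ≡ true → f ≢ out × (f ≡ inn ⊎ S f ≡ true)
swapEdge-true⁻ S {out} {inn} {f} Tf with f ≟ out | f ≟ inn
... | no f≢out | yes f≡inn = f≢out , inj₁ f≡inn
... | no f≢out | no _      = f≢out , inj₂ Tf

swapEdge-exchange : ∀ {m} {A B : EdgeSet m} {e e'} → e ≢ e' →
  A e ≡ false → A e' ≡ true → B e ≡ true → B e' ≡ false →
  ∀ x → bit (swapEdge A e' e x) + bit (swapEdge B e e' x) ≡ bit (A x) + bit (B x)
swapEdge-exchange {e = e} {e'} e≢e' Ae Ae' Be Be' x with x ≟ e | x ≟ e'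
... | yes refl | yes e≡e' = ⊥-elim (e≢e' e≡e')
... | yes refl | no _     rewrite Ae | Be = refl
... | no _     | yes refl rewrite Ae' | Be' = refl
... | no _     | no _     = refl

update-≡ : ∀ {k m} (f : Fin k → EdgeSet m) j v → update f j v j ≡ v
update-≡ f j v rewrite dec-true (j ≟ j) refl = refl

update-preserves : ∀ {k m} (P : EdgeSet m → Set) {f : Fin k → EdgeSet m} {j v} →
  (∀ l → P (f l)) → P v → ∀ l → P (update f j v l)
update-preserves P {j = j} Pf Pv l with l ≟ j
... | yes _ = Pv
... | no _  = Pf l

count-update : ∀ {k m} (f : Fin k → EdgeSet m) j (v : EdgeSet m) x →
  count (λ l → update f j v l x) ≡ bit (v x) + count (remove (λ l → f l x) j)
count-update f j v x =
  trans (count-remove _ j) (cong₂ _+_ (cong (λ S → bit (S x)) (update-≡ f j v)) (count-cong agree))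
  where
  agree : ∀ l → remove (λ l → update f j v l x) j l ≡ remove (λ l → f l x) j l
  agree l with l ≟ j
  ... | yes _ = refl
  ... | no _  = refl

IsEdgePartition-update : ∀ {k m} {ψ φ : Fin k → EdgeSet m} {i j} {S R : EdgeSet m} →
  IsEdgePartition k ψ φ → (∀ x → bit (S x) + bit (R x) ≡ bit (ψ j x) + bit (φ i x)) →
  IsEdgePartition k (update ψ j S) (update φ i R)
IsEdgePartition-update {k} {ψ = ψ} {φ} {i} {j} {S} {R} partition exchange x = begin
  count (λ l → update ψ j S l x) + count (λ l → update φ i R l x)
    ≡⟨ cong₂ _+_ (count-update ψ j S x) (count-update φ i R x) ⟩
  (bit (S x) + rψ) + (bit (R x) + rφ)          ≡⟨ interchange (bit (S x)) rψ (bit (R x)) rφ ⟩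
  (bit (S x) + bit (R x)) + (rψ + rφ)          ≡⟨ cong (_+ (rψ + rφ)) (exchange x) ⟩
  (bit (ψ j x) + bit (φ i x)) + (rψ + rφ)      ≡⟨ interchange (bit (ψ j x)) (bit (φ i x)) rψ rφ ⟩
  (bit (ψ j x) + rψ) + (bit (φ i x) + rφ)      ≡⟨ cong₂ _+_ (count-remove _ j) (count-remove _ i) ⟨
  count (λ l → ψ l x) + count (λ l → φ l x)    ≡⟨ partition x ⟩
  k                                            ∎
  where
  rψ rφ : ℕ
  rψ = count (remove (λ l → ψ l x) j)
  rφ = count (remove (λ l → φ l x) i)

_⊆_ : ∀ {m} → EdgeSet m → EdgeSet m → Set
A ⊆ B = ∀ f → A f ≡ true → B f ≡ true

remove-⊆ : ∀ {m} {A : EdgeSet m} {g} → remove A g ⊆ A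
remove-⊆ {A = A} f = proj₂ ∘ remove-true⁻ A

remove-mono : ∀ {m} {A B : EdgeSet m} {g} → A ⊆ B → remove A g ⊆ remove B g
remove-mono {A = A} {B} A⊆B f r = let (f≢g , Af) = remove-true⁻ A r in remove-true⁺ B f≢g (A⊆B f Af)

remove-comm : ∀ {m} {A : EdgeSet m} {f g} → remove (remove A f) g ⊆ remove (remove A g) f
remove-comm {A = A} {f} {g} h r =
  let (h≢g , r') = remove-true⁻ (remove A f) {g} {h} r ; (h≢f , Ah) = remove-true⁻ A {f} {h} r'
  in remove-true⁺ (remove A g) {f} {h} h≢f (remove-true⁺ A {g} {h} h≢g Ah)

module _ {n m} {G : Graph n m} where

  HasEdgeAt : Fin n → EdgeSet m → Set
  HasEdgeAt c A = Σ (Fin m) λ f → A f ≡ true × Incident G f c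

  OnlyEdgeAt : Fin n → EdgeSet m → Fin m → Set
  OnlyEdgeAt c A g = ∀ f → A f ≡ true → Incident G f c → f ≡ g

  Joins : Fin m → Fin n → Fin n → Set
  Joins g x y = (proj₁ (G g) ≡ x × proj₂ (G g) ≡ y) ⊎ (proj₁ (G g) ≡ y × proj₂ (G g) ≡ x)

  incident⇒joins : ∀ {g c} → Incident G g c → ∃ (Joins g c)
  incident⇒joins (inj₁ p) = _ , inj₁ (p , refl)
  incident⇒joins (inj₂ p) = _ , inj₂ (refl , p)

  joins-loop : ∀ {g c} → Joins g c c → proj₁ (G g) ≡ proj₂ (G g)
  joins-loop (inj₁ (p , q)) = trans p (sym q)
  joins-loop (inj₂ (p , q)) = trans p (sym q)

  Conn-mono : ∀ {A B x y} → A ⊆ B → Conn G A x y → Conn G B x y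
  Conn-mono A⊆B here           = here
  Conn-mono A⊆B (fwd f Af p w) = fwd f (A⊆B f Af) p (Conn-mono A⊆B w)
  Conn-mono A⊆B (bwd f Af p w) = bwd f (A⊆B f Af) p (Conn-mono A⊆B w)

  Conn-trans : ∀ {A x y z} → Conn G A x y → Conn G A y z → Conn G A x z
  Conn-trans here           w' = w'
  Conn-trans (fwd f Af p w) w' = fwd f Af p (Conn-trans w w')
  Conn-trans (bwd f Af p w) w' = bwd f Af p (Conn-trans w w')

  Conn-edge : ∀ {A g} → A g ≡ true → Conn G A (proj₁ (G g)) (proj₂ (G g))
  Conn-edge Ag = fwd _ Ag refl here

  Conn-sym : ∀ {A x y} → Conn G A x y → Conn G A y x
  Conn-sym here              = here
  Conn-sym (fwd f Af refl w) = Conn-trans (Conn-sym w) (bwd f Af refl here)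
  Conn-sym (bwd f Af refl w) = Conn-trans (Conn-sym w) (Conn-edge Af)

  Conn-joins : ∀ {A g x y} → Joins g x y → Conn G A (proj₁ (G g)) (proj₂ (G g)) → Conn G A x y
  Conn-joins (inj₁ (refl , refl)) w = w
  Conn-joins (inj₂ (refl , refl)) w = Conn-sym w

  Conn-map : ∀ {A B x y} (r : Fin n → Fin n) →
    (∀ f → A f ≡ true → Conn G B (r (proj₁ (G f))) (r (proj₂ (G f)))) →
    Conn G A x y → Conn G B (r x) (r y)
  Conn-map r step here              = here
  Conn-map r step (fwd f Af refl w) = Conn-trans (step f Af) (Conn-map r step w)
  Conn-map r step (bwd f Af refl w) = Conn-trans (Conn-sym (step f Af)) (Conn-map r step w)

  Conn-edgeAt : ∀ {A c y} → Conn G A c y → y ≢ c → HasEdgeAt c A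
  Conn-edgeAt here           y≢c = ⊥-elim (y≢c refl)
  Conn-edgeAt (fwd f Af p _) _   = f , Af , inj₁ p
  Conn-edgeAt (bwd f Af p _) _   = f , Af , inj₂ p

  Conn-⊎-trans : ∀ {A x u v a b} → Conn G A u a → Conn G A v b →
    Conn G A x u ⊎ Conn G A x v → Conn G A x a ⊎ Conn G A x b
  Conn-⊎-trans ua vb = Sum.map (λ xu → Conn-trans xu ua) (λ xv → Conn-trans xv vb)

  IsForest-anti : ∀ {A B} → A ⊆ B → IsForest G B → IsForest G A
  IsForest-anti A⊆B forest f Af w = forest f (A⊆B f Af) (Conn-mono (remove-mono A⊆B) w)

  IsForest-loopFree : ∀ {A g} → IsForest G A → A g ≡ true → proj₁ (G g) ≢ proj₂ (G g)
  IsForest-loopFree forest Ag loop = forest _ Ag (subst (Conn G _ _) loop here)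

  retract : Fin n → Fin n → Fin n → Fin n
  retract c d x = if does (x ≟ c) then d else x

  retract-≢ : ∀ {c d x} → x ≢ c → retract c d x ≡ x
  retract-≢ {c} {x = x} x≢c rewrite dec-false (x ≟ c) x≢c = refl

  retract-joins : ∀ {B g c d} → Joins g c d →
    Conn G B (retract c d (proj₁ (G g))) (retract c d (proj₂ (G g)))
  retract-joins {c = c} {d} ends = subst₂ (Conn G _) (sym (end ends₁)) (sym (end ends₂)) here
    where
    end : ∀ {x} → x ≡ c ⊎ x ≡ d → retract c d x ≡ d
    end {x} x∈cd with x ≟ c
    ... | yes _   = refl
    ... | no x≢c = [ ⊥-elim ∘ x≢c , id ]′ x∈cd
    ends₁ = Sum.map proj₁ proj₁ ends
    ends₂ = Sum.map proj₂ proj₂ (Sum.swap ends)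

  -- Contracting the leaf edge g onto its other end d maps every walk in A to a walk avoiding g.
  Conn-removeLeaf : ∀ {A c g x y} → OnlyEdgeAt c A g →
    Incident G g c → x ≢ c → y ≢ c → Conn G A x y → Conn G (remove A g) x y
  Conn-removeLeaf {A} {c} {g} leaf g-inc x≢c y≢c w =
    subst₂ (Conn G _) (retract-≢ x≢c) (retract-≢ y≢c) (Conn-map (retract c d) step w)
    where
    d = proj₁ (incident⇒joins g-inc)
    step : ∀ f → A f ≡ true →
      Conn G (remove A g) (retract c d (proj₁ (G f))) (retract c d (proj₂ (G f)))
    step f Af with f ≟ g
    ... | yes refl = retract-joins (proj₂ (incident⇒joins g-inc))
    ... | no f≢g
      rewrite retract-≢ {d = d} (f≢g ∘ leaf f Af ∘ inj₁)
            | retract-≢ {d = d} (f≢g ∘ leaf f Af ∘ inj₂)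
      = Conn-edge (remove-true⁺ A f≢g Af)

  IsForest-addLeaf : ∀ {A c g d} → OnlyEdgeAt c A g →
    Joins g c d → d ≢ c → IsForest G (remove A g) → IsForest G A
  IsForest-addLeaf {A} {g = g} leaf ends d≢c forest f Af w with f ≟ g
  ... | yes refl =
    let (h , r , h-inc) = Conn-edgeAt (Conn-joins ends w) d≢c
    in proj₁ (remove-true⁻ A r) (leaf h (remove-⊆ {A = A} h r) h-inc)
  ... | no f≢g = forest f (remove-true⁺ A f≢g Af) (Conn-mono remove-comm
    (Conn-removeLeaf (λ h r → leaf h (remove-⊆ {A = A} h r)) (Sum.map proj₁ proj₂ ends)
      (f≢g ∘ leaf f Af ∘ inj₁) (f≢g ∘ leaf f Af ∘ inj₂) w))

  IsSpanning2Forest-cover : ∀ {A a b} → IsSpanning2Forest G A → ¬ Conn G A a b →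
    ∀ x → Conn G A x a ⊎ Conn G A x b
  IsSpanning2Forest-cover {a = a} {b} (_ , _ , _ , _ , cover) ¬ab with cover a | cover b
  ... | inj₁ au | inj₁ bu = ⊥-elim (¬ab (Conn-trans au (Conn-sym bu)))
  ... | inj₂ av | inj₂ bv = ⊥-elim (¬ab (Conn-trans av (Conn-sym bv)))
  ... | inj₁ au | inj₂ bv = λ x → Conn-⊎-trans (Conn-sym au) (Conn-sym bv) (cover x)
  ... | inj₂ av | inj₁ bu = λ x → Sum.swap (Conn-⊎-trans (Conn-sym bu) (Conn-sym av) (cover x))

  Good2Forest-fromCover : ∀ {A V c a b} → IsForest G A →
    V a ≡ true → a ≢ c → V b ≡ true → b ≢ c → ¬ Conn G A a b →
    (∀ x → Conn G A x a ⊎ Conn G A x b) → Good2Forest G V c A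
  Good2Forest-fromCover {A} {a = a} {b} forest Va a≢c Vb b≢c ¬ab cover =
    (forest , a , b , ¬ab , cover) ,
    (sideOf ∘ cover) ,
    ((a , Va , a≢c , sideOf-a (cover a)) , (b , Vb , b≢c , sideOf-b (cover b))) ,
    (λ x y _ _ → sameSide (cover x) (cover y)) ,
    (λ x y _ _ → differentSides (cover x) (cover y))
    where
    sideOf : ∀ {x} → Conn G A x a ⊎ Conn G A x b → Bool
    sideOf = [ const true , const false ]′
    sideOf-a : (w : Conn G A a a ⊎ Conn G A a b) → sideOf w ≡ true
    sideOf-a (inj₁ _)  = refl
    sideOf-a (inj₂ ab) = ⊥-elim (¬ab ab)
    sideOf-b : (w : Conn G A b a ⊎ Conn G A b b) → sideOf w ≡ false
    sideOf-b (inj₁ ba) = ⊥-elim (¬ab (Conn-sym ba))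
    sideOf-b (inj₂ _)  = refl
    sameSide : ∀ {x y} (wx : Conn G A x a ⊎ Conn G A x b) (wy : Conn G A y a ⊎ Conn G A y b) →
      sideOf wx ≡ sideOf wy → Conn G A x y
    sameSide (inj₁ xa) (inj₁ ya) _ = Conn-trans xa (Conn-sym ya)
    sameSide (inj₂ xb) (inj₂ yb) _ = Conn-trans xb (Conn-sym yb)
    sameSide (inj₁ _)  (inj₂ _)  ()
    sameSide (inj₂ _)  (inj₁ _)  ()
    differentSides : ∀ {x y} (wx : Conn G A x a ⊎ Conn G A x b) (wy : Conn G A y a ⊎ Conn G A y b) →
      sideOf wx ≢ sideOf wy → ¬ Conn G A x y
    differentSides (inj₁ _)  (inj₁ _)  s≢s _  = s≢s refl
    differentSides (inj₂ _)  (inj₂ _)  s≢s _  = s≢s refl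
    differentSides (inj₁ xa) (inj₂ yb) _   xy = ¬ab (Conn-trans (Conn-sym xa) (Conn-trans xy yb))
    differentSides (inj₂ xb) (inj₁ ya) _   xy =
      ¬ab (Conn-trans (Conn-sym ya) (Conn-trans (Conn-sym xy) xb))

  Good2Forest-edgeAt : ∀ {A V c} → V c ≡ true → Good2Forest G V c A → HasEdgeAt c A
  Good2Forest-edgeAt {c = c} Vc
    (_ , side , ((a , Va , a≢c , sa) , (b , Vb , b≢c , sb)) , sameSide⇒Conn , _) with side c in sc
  ... | true  = Conn-edgeAt (sameSide⇒Conn c a Vc Va (trans sc (sym sa))) a≢c
  ... | false = Conn-edgeAt (sameSide⇒Conn c b Vc Vb (trans sc (sym sb))) b≢c

  module SwapAtLeaf {S : EdgeSet m} {c : Fin n} {out inn : Fin m}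
    (leaf : OnlyEdgeAt c S out) (out-inc : Incident G out c)
    (inn-inc : Incident G inn c) (inn-loopFree : proj₁ (G inn) ≢ proj₂ (G inn))
    (inn≢out : inn ≢ out)
    where

    T : EdgeSet m
    T = swapEdge S out inn

    T-leaf : OnlyEdgeAt c T inn
    T-leaf f Tf f-inc with swapEdge-true⁻ S Tf
    ... | _     , inj₁ f≡inn = f≡inn
    ... | f≢out , inj₂ Sf    = ⊥-elim (f≢out (leaf f Sf f-inc))

    remove-out⊆remove-inn : remove S out ⊆ remove T inn
    remove-out⊆remove-inn f r =
      let (f≢out , Sf) = remove-true⁻ S r
      in remove-true⁺ T {inn} {f} (λ { refl → inn≢out (leaf inn Sf inn-inc) })
           (swapEdge-keep S {out} {inn} f≢out Sf)

    remove-inn⊆S : remove T inn ⊆ S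
    remove-inn⊆S f r with remove-true⁻ T r
    ... | f≢inn , Tf with swapEdge-true⁻ S Tf
    ... | _ , inj₁ f≡inn = ⊥-elim (f≢inn f≡inn)
    ... | _ , inj₂ Sf    = Sf

    Conn-swap : ∀ {x y} → x ≢ c → y ≢ c → Conn G S x y → Conn G T x y
    Conn-swap x≢c y≢c =
      Conn-mono remove-⊆ ∘ Conn-mono remove-out⊆remove-inn ∘ Conn-removeLeaf leaf out-inc x≢c y≢c

    Conn-unswap : ∀ {x y} → x ≢ c → y ≢ c → Conn G T x y → Conn G S x y
    Conn-unswap x≢c y≢c = Conn-mono remove-inn⊆S ∘ Conn-removeLeaf T-leaf inn-inc x≢c y≢c

    d : Fin n
    d = proj₁ (incident⇒joins inn-inc)

    inn-joins : Joins inn c d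
    inn-joins = proj₂ (incident⇒joins inn-inc)

    d≢c : d ≢ c
    d≢c d≡c = inn-loopFree (joins-loop (subst (Joins inn c) d≡c inn-joins))

    T-reachesNonCentre : ∀ x → Σ (Fin n) λ z → z ≢ c × Conn G T x z
    T-reachesNonCentre x with x ≟ c
    ... | yes refl = d , d≢c , Conn-joins inn-joins (Conn-edge (swapEdge-in S inn≢out))
    ... | no x≢c   = x , x≢c , here

    swap-IsForest : IsForest G S → IsForest G T
    swap-IsForest forest = IsForest-addLeaf T-leaf inn-joins d≢c (IsForest-anti remove-inn⊆S forest)

    swap-IsSpanningTree : IsSpanningTree G S → IsSpanningTree G T
    swap-IsSpanningTree (forest , conn) = swap-IsForest forest , λ x y →
      let (z , z≢c , xz) = T-reachesNonCentre x ; (z' , z'≢c , yz') = T-reachesNonCentre y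
      in Conn-trans xz (Conn-trans (Conn-swap z≢c z'≢c (conn z z')) (Conn-sym yz'))

    swap-Good2Forest : ∀ {V} → Good2Forest G V c S → Good2Forest G V c T
    swap-Good2Forest
      (spanning , _ , ((a , Va , a≢c , sa) , (b , Vb , b≢c , sb)) , _ , differentSides) =
      Good2Forest-fromCover (swap-IsForest (proj₁ spanning)) Va a≢c Vb b≢c
        (¬S-ab ∘ Conn-unswap a≢c b≢c) T-cover
      where
      ¬S-ab : ¬ Conn G S a b
      ¬S-ab = differentSides a b Va Vb λ sa≡sb →
        contradiction (trans (sym sa) (trans sa≡sb sb)) λ ()
      T-cover : ∀ x → Conn G T x a ⊎ Conn G T x b
      T-cover x =
        let (z , z≢c , xz) = T-reachesNonCentre x
        in Sum.map (Conn-trans xz ∘ Conn-swap z≢c a≢c) (Conn-trans xz ∘ Conn-swap z≢c b≢c)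
             (IsSpanning2Forest-cover spanning ¬S-ab z)

  incidentAt : Fin n → EdgeSet m
  incidentAt c e = does (proj₁ (G e) ≟ c) ∨ does (proj₂ (G e) ≟ c)

  incidentAt-true : ∀ {c e} → Incident G e c → incidentAt c e ≡ true
  incidentAt-true {c} {e} (inj₁ p) rewrite dec-true (proj₁ (G e) ≟ c) p = refl
  incidentAt-true {c} {e} (inj₂ p) rewrite dec-true (proj₂ (G e) ≟ c) p = ∨-zeroʳ _

  count-incidentAt≤degree : ∀ c → count (incidentAt c) ≤ degree G c
  count-incidentAt≤degree c =
    subst (count (incidentAt c) ≤_)
      (count-∨+count-∧ (λ e → does (proj₁ (G e) ≟ c)) (λ e → does (proj₂ (G e) ≟ c))) (m≤m+n _ _)

  degree2-incident : ∀ {c f g h} → degree G c ≡ 2 → f ≢ g →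
    Incident G f c → Incident G g c → Incident G h c → h ≡ f ⊎ h ≡ g
  degree2-incident {c} {f} {g} {h} deg f≢g f-inc g-inc h-inc with h ≟ f | h ≟ g
  ... | yes h≡f | _       = inj₁ h≡f
  ... | no _    | yes h≡g = inj₂ h≡g
  ... | no h≢f  | no h≢g  = contradiction
    (≤-trans (count-≥3 (incidentAt c) (≢-sym f≢g) h≢f h≢g
               (incidentAt-true f-inc) (incidentAt-true g-inc) (incidentAt-true h-inc))
             (subst (count (incidentAt c) ≤_) deg (count-incidentAt≤degree c)))
    λ { (s≤s (s≤s ())) }

  degree2-∨ : ∀ {A c f g} → degree G c ≡ 2 → f ≢ g → Incident G f c → Incident G g c →
    HasEdgeAt c A → A f ∨ A g ≡ true
  degree2-∨ {A} {f = f} deg f≢g f-inc g-inc (h , Ah , h-inc)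
    with degree2-incident deg f≢g f-inc g-inc h-inc
  ... | inj₁ refl rewrite Ah = refl
  ... | inj₂ refl rewrite Ah = ∨-zeroʳ (A f)

  exactlyOneAt-intro : ∀ {A c} → HasEdgeAt c A →
    (∀ {f g} → f ≢ g → Incident G f c → Incident G g c → A f ∧ A g ≡ false) → ExactlyOneAt G c A
  exactlyOneAt-intro (e , Ae , e-inc) disjoint = e , Ae , e-inc , λ f Af f-inc →
    decidable-stable (f ≟ e) λ f≢e →
      contradiction (trans (sym Ae) (∧-false (disjoint f≢e f-inc e-inc) Af)) λ ()

  exactlyOneAt-unique : ∀ {A c g} → ExactlyOneAt G c A → A g ≡ true → Incident G g c →
    OnlyEdgeAt c A g
  exactlyOneAt-unique (_ , _ , _ , unique) Ag g-inc f Af f-inc =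
    trans (unique f Af f-inc) (sym (unique _ Ag g-inc))

module GoodPartitionAt
  {n m} {G : Graph n m} {V : VertexSet n} {c : Fin n} {k : ℕ} {ψ φ : Fin k → EdgeSet m}
  (Vc : V c ≡ true) (deg : degree G c ≡ 2) (partition : IsEdgePartition k ψ φ)
  (trees : ∀ j → IsSpanningTree G (ψ j)) (forests : ∀ i → Good2Forest G V c (φ i))
  where

  ψ-edgeAt : ∀ j → HasEdgeAt c (ψ j)
  ψ-edgeAt j = let (_ , _ , ((a , _ , a≢c , _) , _) , _) = forests j in
    Conn-edgeAt (proj₂ (trees j) c a) a≢c

  φ-edgeAt : ∀ i → HasEdgeAt c (φ i)
  φ-edgeAt i = Good2Forest-edgeAt Vc (forests i)

  countBoth≡0 : ∀ {f g} → f ≢ g → Incident G f c → Incident G g c →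
    count (λ l → ψ l f ∧ ψ l g) + count (λ l → φ l f ∧ φ l g) ≡ 0
  countBoth≡0 {f} {g} f≢g f-inc g-inc = +-cancelˡ-≡ (k + k) _ _ (begin
    (k + k) + (Bψ + Bφ)              ≡⟨ interchange k k Bψ Bφ ⟩
    (k + Bψ) + (k + Bφ)              ≡⟨ cong₂ _+_ (countBoth ψ ψ-edgeAt) (countBoth φ φ-edgeAt) ⟩
    (Fψ + Gψ) + (Fφ + Gφ)            ≡⟨ interchange Fψ Gψ Fφ Gφ ⟩
    (Fψ + Fφ) + (Gψ + Gφ)            ≡⟨ cong₂ _+_ (partition f) (partition g) ⟩
    k + k                            ≡⟨ +-identityʳ (k + k) ⟨
    (k + k) + 0                      ∎)
    where
    Bψ Bφ Fψ Fφ Gψ Gφ : ℕ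
    Bψ = count (λ l → ψ l f ∧ ψ l g)
    Bφ = count (λ l → φ l f ∧ φ l g)
    Fψ = count (λ l → ψ l f)
    Fφ = count (λ l → φ l f)
    Gψ = count (λ l → ψ l g)
    Gφ = count (λ l → φ l g)
    countBoth : (P : Fin k → EdgeSet m) → (∀ l → HasEdgeAt c (P l)) →
      k + count (λ l → P l f ∧ P l g) ≡ count (λ l → P l f) + count (λ l → P l g)
    countBoth P edgeAt =
      trans (cong (_+ count (λ l → P l f ∧ P l g))
               (sym (count-true λ l → degree2-∨ deg f≢g f-inc g-inc (edgeAt l))))
        (count-∨+count-∧ (λ l → P l f) (λ l → P l g))

  ψ-exactlyOneAt : ∀ j → ExactlyOneAt G c (ψ j)
  ψ-exactlyOneAt j = exactlyOneAt-intro (ψ-edgeAt j) λ f≢g f-inc g-inc →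
    count≡0⇒false (m+n≡0⇒m≡0 _ (countBoth≡0 f≢g f-inc g-inc)) j

  φ-exactlyOneAt : ∀ i → ExactlyOneAt G c (φ i)
  φ-exactlyOneAt i = exactlyOneAt-intro (φ-edgeAt i) λ f≢g f-inc g-inc →
    count≡0⇒false (m+n≡0⇒n≡0 _ (countBoth≡0 f≢g f-inc g-inc)) i

  notInEveryTree : ∀ {i e} → φ i e ≡ true → ∃ λ j → ψ j e ≢ true
  notInEveryTree {i} {e} φie = ¬∀⟶∃¬ k _ (λ l → ψ l e ≟ᵇ true) λ inAll →
    contradiction (trans (sym φie) (count≡0⇒false (φ-count≡0 inAll) i)) λ ()
    where
    φ-count≡0 : (∀ l → ψ l e ≡ true) → count (λ l → φ l e) ≡ 0
    φ-count≡0 inAll = +-cancelˡ-≡ k _ 0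
      (trans (cong (_+ count (λ l → φ l e)) (sym (count-true inAll)))
        (trans (partition e) (sym (+-identityʳ k))))

  swapPartner : ∀ i → Σ (Fin k) λ j → Σ (Fin m) λ e → Σ (Fin m) λ e' →
    φ i e ≡ true × Incident G e c × ψ j e' ≡ true × Incident G e' c × e ≢ e'
  swapPartner i with φ-exactlyOneAt i
  ... | e , φie , e-inc , _ with notInEveryTree φie
  ... | j , e∉ψj with ψ-exactlyOneAt j
  ... | e' , ψje' , e'-inc , _ = j , e , e' , φie , e-inc , ψje' , e'-inc , λ { refl → e∉ψj ψje' }

  swap-GoodPartition : ∀ i j e e' →
    φ i e ≡ true → Incident G e c → ψ j e' ≡ true → Incident G e' c → e ≢ e' →
    GoodPartition G V c k (update ψ j (swapEdge (ψ j) e' e)) (update φ i (swapEdge (φ i) e e'))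
  swap-GoodPartition i j e e' φie e-inc ψje' e'-inc e≢e' =
    IsEdgePartition-update partition (swapEdge-exchange e≢e' ψje≡false ψje' φie φie'≡false) ,
    update-preserves (IsSpanningTree G) trees
      (SwapAtLeaf.swap-IsSpanningTree ψ-leaf e'-inc e-inc
        (IsForest-loopFree (proj₁ (proj₁ (forests i))) φie) e≢e' (trees j)) ,
    update-preserves (Good2Forest G V c) forests
      (SwapAtLeaf.swap-Good2Forest φ-leaf e-inc e'-inc
        (IsForest-loopFree (proj₁ (trees j)) ψje') (≢-sym e≢e') (forests i))
    where
    ψ-leaf = exactlyOneAt-unique (ψ-exactlyOneAt j) ψje' e'-inc
    φ-leaf = exactlyOneAt-unique (φ-exactlyOneAt i) φie e-inc
    ψje≡false : ψ j e ≡ false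
    ψje≡false = ¬-not λ ψje → e≢e' (ψ-leaf e ψje e-inc)
    φie'≡false : φ i e' ≡ false
    φie'≡false = ¬-not λ φie' → e≢e' (sym (φ-leaf e' φie' e'-inc))

lemma7p5 : (p : ℕ) → Prime p → {n m : ℕ} (G : Graph n m) → Connected G →
    (V : VertexSet n) (c : Fin n) → V c ≡ true → degree G c ≡ 2 →
    (ψ φ : Fin (p ∸ 1) → EdgeSet m) → GoodPartition G V c (p ∸ 1) ψ φ →
    ((∀ j → ExactlyOneAt G c (ψ j)) × (∀ i → ExactlyOneAt G c (φ i)))
    × (∀ i → Σ (Fin (p ∸ 1)) λ j → Σ (Fin m) λ e → Σ (Fin m) λ e' →
         φ i e ≡ true × Incident G e c × ψ j e' ≡ true × Incident G e' c × e ≢ e')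
    × (∀ i j e e' → φ i e ≡ true → Incident G e c → ψ j e' ≡ true → Incident G e' c →
         e ≢ e' →
         GoodPartition G V c (p ∸ 1)
           (update ψ j (swapEdge (ψ j) e' e))
           (update φ i (swapEdge (φ i) e e')))
lemma7p5 p _ G _ V c Vc deg ψ φ (partition , trees , forests) =
  (ψ-exactlyOneAt , φ-exactlyOneAt) , swapPartner , swap-GoodPartition
  where open GoodPartitionAt Vc deg partition trees forests
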